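{- Let $x_1,x_2,\ldots$ be complex numbers and let $y_1,y_2,\ldots$ be their invert transform, i.e. $1+\sum_{n\ge1}y_nt^n=\bigl(1-\sum_{n\ge1}x_nt^n\bigr)^{ -1}$. Then for all integers $1\le k\le n$, \[ k!\,B_{n,k}(y_1,\,2!\,y_2,\,3!\,y_3,\ldots)=\sum_{i=k}^{n}\binom{i-1}{k-1}\,i!\,B_{n,i}(x_1,\,2!\,x_2,\,3!\,x_3,\ldots). \]
   Context: $B_{n,k}$ denotes the partial Bell polynomial: $B_{n,k}(z_1,z_2,\ldots)=\sum \frac{n!}{j_1!j_2!\cdots (1!)^{j_1}(2!)^{j_2}\cdots}z_1^{j_1}z_2^{j_2}\cdots$, the sum over nonnegative integers $j_1,j_2,\ldots$ with $\sum_i j_i=k$ and $\sum_i i\,j_i=n$. -}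

module Defs where

open import Level using (Level)
open import Data.Nat as ℕ using (ℕ; zero; suc; _∸_; _≡ᵇ_; NonZero)
open import Data.Nat.Properties using (_!≢0; m^n≢0; m*n≢0)
open import Data.Nat.DivMod using (_/_)
open import Data.Bool using (Bool; true; false; _∧_; if_then_else_)
open import Data.List using (List; []; _∷_; map; concatMap; filterᵇ; upTo)
open import Algebra.Bundles using (CommutativeRing)

-- Enumeration of index tuples (j_1,...,j_len), each entry in 0..bound,
-- represented as a list whose i-th element (1-based) is j_i.

tuples : ℕ → ℕ → List (List ℕ)
tuples bound zero    = [] ∷ []
tuples bound (suc l) =
  concatMap (λ j → map (j ∷_) (tuples bound l)) (upTo (suc bound))

sumJ : List ℕ → ℕ
sumJ []       = 0
sumJ (j ∷ js) = j ℕ.+ sumJ js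

weightFrom : ℕ → List ℕ → ℕ
weightFrom i []       = 0
weightFrom i (j ∷ js) = i ℕ.* j ℕ.+ weightFrom (suc i) js

denomFrom : ℕ → List ℕ → ℕ
denomFrom i []       = 1
denomFrom i (j ∷ js) = (j ℕ.! ℕ.* ((i ℕ.!) ℕ.^ j)) ℕ.* denomFrom (suc i) js

denomFrom-nz : ∀ i js → NonZero (denomFrom i js)
denomFrom-nz i []       = _
denomFrom-nz i (j ∷ js) =
  let instance _ = j !≢0
      instance _ = i !≢0
      instance _ = m^n≢0 (i ℕ.!) j
      instance _ = m*n≢0 (j ℕ.!) ((i ℕ.!) ℕ.^ j)
      instance _ = denomFrom-nz (suc i) js
  in m*n≢0 (j ℕ.! ℕ.* ((i ℕ.!) ℕ.^ j)) (denomFrom (suc i) js)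

-- the integer coefficient  n! / (j_1! j_2! ⋯ (1!)^{j_1} (2!)^{j_2} ⋯)
-- (this division in ℕ is exact: it counts set partitions of the given type)
bellCoeff : ℕ → List ℕ → ℕ
bellCoeff n js = (n ℕ.! / denomFrom 1 js) {{denomFrom-nz 1 js}}

module _ {c ℓ : Level} (R : CommutativeRing c ℓ) where
  open CommutativeRing R

  _×ₙ_ : ℕ → Carrier → Carrier
  zero  ×ₙ a = 0#
  suc n ×ₙ a = a + (n ×ₙ a)

  _^ₙ_ : Carrier → ℕ → Carrier
  a ^ₙ zero  = 1#
  a ^ₙ suc n = a * (a ^ₙ n)

  sumR : List Carrier → Carrier
  sumR []       = 0#
  sumR (a ∷ as) = a + sumR as

  -- Σ_{i=a}^{b} f i   (empty if b < a)
  sumFromTo : ℕ → ℕ → (ℕ → Carrier) → Carrier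
  sumFromTo a b f = sumR (map (λ t → f (a ℕ.+ t)) (upTo (suc b ∸ a)))

  monoFrom : (ℕ → Carrier) → ℕ → List ℕ → Carrier
  monoFrom z i []       = 1#
  monoFrom z i (j ∷ js) = (z i ^ₙ j) * monoFrom z (suc i) js

  -- Partial Bell polynomial B_{n,k}(z_1, z_2, …), z i = z_i (z 0 unused).
  -- Sum over (j_1,…,j_n) with Σ j_i = k and Σ i j_i = n; the variables
  -- j_i with i > n are forced to be 0 by Σ i j_i = n, so they are omitted.
  admissible : ℕ → ℕ → List ℕ → Bool
  admissible n k js = (sumJ js ≡ᵇ k) ∧ (weightFrom 1 js ≡ᵇ n)

  Bell : ℕ → ℕ → (ℕ → Carrier) → Carrier
  Bell n k z =
    sumR (map (λ js → bellCoeff n js ×ₙ monoFrom z 1 js)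
              (filterᵇ (admissible n k) (tuples n n)))

  -- y is the invert transform of x:
  --   (1 + Σ_{n≥1} y_n t^n) · (1 - Σ_{n≥1} x_n t^n) = 1   as formal power series,
  -- written coefficientwise (coefficient of t^0 is 1·1 = 1 automatically).
  -- Indices: x n = x_n, y n = y_n for n ≥ 1; x 0, y 0 unused.
  seriesY : (ℕ → Carrier) → ℕ → Carrier
  seriesY y zero    = 1#
  seriesY y (suc n) = y (suc n)

  seriesOneMinusX : (ℕ → Carrier) → ℕ → Carrier
  seriesOneMinusX x zero    = 1#
  seriesOneMinusX x (suc n) = - x (suc n)

  IsInvertTransform : (ℕ → Carrier) → (ℕ → Carrier) → Set ℓ
  IsInvertTransform x y =
    ∀ n → 1 ℕ.≤ n →
      sumFromTo 0 n (λ i → seriesY y i * seriesOneMinusX x (n ∸ i)) ≈ 0#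

  factScaled : (ℕ → Carrier) → ℕ → Carrier
  factScaled z i = (i ℕ.!) ×ₙ z i

-- Put X = Σₙ xₙ tⁿ and Y = Σₙ yₙ tⁿ (n ≥ 1); the hypothesis says (1 + Y)(1 − X) = 1.
--
-- Exponential formula: k! Bₙ,ₖ(z₁, 2! z₂, …) = n! [tⁿ] Zᵏ for Z = Σᵢ zᵢ tⁱ. Expanding Zᵏ
-- multinomially, the monomial Πᵢ zᵢ^jᵢ gets the coefficient k!/Πᵢ jᵢ!, and
-- k! · n!/(Πᵢ jᵢ! (i!)^jᵢ) · Πᵢ (i!)^jᵢ = n! · k!/Πᵢ jᵢ!.
--
-- Powers of Y: Yᵏ = Tₖ := Σᵢ C(i − 1, k − 1) Xⁱ, whose coefficients count compositions of i into
-- k parts. Pascal's rule gives Tₖ₊₁ = X Tₖ₊₁ + X Tₖ, and Y = X Y + X gives Yᵏ⁺¹ = X Yᵏ⁺¹ + X Yᵏ;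
-- by induction both solve Z = X Z + X Yᵏ, whose only solution is (1 + Y) X Yᵏ.
--
-- Taking n! [tⁿ] of Yᵏ and applying the exponential formula on both sides gives the theorem.

module Submission where

open import Algebra.Bundles using (CommutativeRing)
open import Data.Nat using (ℕ)
open import Defs

module Counting where

  open import Data.Nat
  open import Data.Nat.Properties
  open import Data.Nat.Combinatorics
  open import Data.Nat.DivMod using (m/n*n≡m; m*n/n≡m)
  open import Data.Nat.Tactic.RingSolver using (solve-∀)
  open import Data.List using (List; []; _∷_)
  open import Data.Bool using (false)
  open import Relation.Binary.PropositionalEquality
  open ≡-Reasoning

  nCk*[k!*[n∸k]!]≡n! : ∀ {n k} → k ≤ n → (n C k) * (k ! * (n ∸ k) !) ≡ n !
  nCk*[k!*[n∸k]!]≡n! {n} {k} k≤n = begin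
    (n C k) * d         ≡⟨ cong (_* d) (nCk≡n!/k![n-k]! k≤n) ⟩
    (n ! / d) * d       ≡⟨ m/n*n≡m (k![n∸k]!∣n! k≤n) ⟩
    n !                 ∎
    where
    d = k ! * (n ∸ k) !
    instance
      _ = k !≢0
      _ = (n ∸ k) !≢0
      _ = m*n≢0 (k !) ((n ∸ k) !)

  [m+n]Cm*[m!*n!]≡[m+n]! : ∀ m n → ((m + n) C m) * (m ! * n !) ≡ (m + n) !
  [m+n]Cm*[m!*n!]≡[m+n]! m n =
    subst (λ t → ((m + n) C m) * (m ! * t !) ≡ (m + n) !) (m+n∸m≡n m n)
          (nCk*[k!*[n∸k]!]≡n! (m≤m+n m n))

  multinomial : List ℕ → ℕ
  multinomial []       = 1
  multinomial (j ∷ js) = ((j + sumJ js) C j) * multinomial js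

  factorialProduct : List ℕ → ℕ
  factorialProduct []       = 1
  factorialProduct (j ∷ js) = j ! * factorialProduct js

  factorialPowersFrom : ℕ → List ℕ → ℕ
  factorialPowersFrom i []       = 1
  factorialPowersFrom i (j ∷ js) = (i !) ^ j * factorialPowersFrom (suc i) js

  multinomial*factorialProduct≡sumJ! : ∀ js → multinomial js * factorialProduct js ≡ sumJ js !
  multinomial*factorialProduct≡sumJ! []       = refl
  multinomial*factorialProduct≡sumJ! (j ∷ js) = begin
    ((j + s) C j) * multinomial js * (j ! * factorialProduct js)
      ≡⟨ rearrange ((j + s) C j) (multinomial js) (j !) (factorialProduct js) ⟩
    ((j + s) C j) * (j ! * (multinomial js * factorialProduct js))
      ≡⟨ cong (λ t → ((j + s) C j) * (j ! * t)) (multinomial*factorialProduct≡sumJ! js) ⟩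
    ((j + s) C j) * (j ! * s !)
      ≡⟨ [m+n]Cm*[m!*n!]≡[m+n]! j s ⟩
    (j + s) ! ∎
    where
    s = sumJ js
    rearrange : ∀ a b c d → a * b * (c * d) ≡ a * (c * (b * d))
    rearrange = solve-∀

  denomFrom≡factorialProduct*factorialPowersFrom :
    ∀ i js → denomFrom i js ≡ factorialProduct js * factorialPowersFrom i js
  denomFrom≡factorialProduct*factorialPowersFrom i []       = refl
  denomFrom≡factorialProduct*factorialPowersFrom i (j ∷ js) = begin
    (j ! * (i !) ^ j) * denomFrom (suc i) js
      ≡⟨ cong ((j ! * (i !) ^ j) *_) (denomFrom≡factorialProduct*factorialPowersFrom (suc i) js) ⟩
    (j ! * (i !) ^ j) * (factorialProduct js * factorialPowersFrom (suc i) js)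
      ≡⟨ interchange (j !) ((i !) ^ j) (factorialProduct js) (factorialPowersFrom (suc i) js) ⟩
    (j ! * factorialProduct js) * ((i !) ^ j * factorialPowersFrom (suc i) js) ∎
    where
    interchange : ∀ a b c d → (a * b) * (c * d) ≡ (a * c) * (b * d)
    interchange = solve-∀

  -- Partitions of a set of (suc b) · j elements into j blocks of size suc b, counted by choosing
  -- the b companions of a fixed element.
  blockPartitions : ℕ → ℕ → ℕ
  blockPartitions b zero    = 1
  blockPartitions b (suc j) = ((suc b * j + b) C (suc b * j)) * blockPartitions b j

  -- Set partitions with j₁ blocks of size suc b, j₂ blocks of size 2 + b, …; for b = 0 this is
  -- the quotient n! / denomFrom 1 js computed by bellCoeff, which is therefore exact.
  typedPartitions : ℕ → List ℕ → ℕ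
  typedPartitions b []       = 1
  typedPartitions b (j ∷ js) =
    ((suc b * j + weightFrom (2 + b) js) C (suc b * j)) * blockPartitions b j * typedPartitions (suc b) js

  blockPartitions-spec : ∀ b j → blockPartitions b j * (j ! * (suc b !) ^ j) ≡ (suc b * j) !
  blockPartitions-spec b zero    = cong _! (sym (*-zeroʳ (suc b)))
  blockPartitions-spec b (suc j) = begin
    (B * blockPartitions b j) * ((suc j * j !) * ((suc b * b !) * (suc b !) ^ j))
      ≡⟨ rearrange B (blockPartitions b j) (suc j) (j !) (suc b) (b !) ((suc b !) ^ j) ⟩
    (suc j * suc b) * (B * (b ! * (blockPartitions b j * (j ! * (suc b !) ^ j))))
      ≡⟨ cong (λ t → (suc j * suc b) * (B * (b ! * t))) (blockPartitions-spec b j) ⟩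
    (suc j * suc b) * (B * (b ! * m !))
      ≡⟨ cong (λ t → (suc j * suc b) * (B * t)) (*-comm (b !) (m !)) ⟩
    (suc j * suc b) * (B * (m ! * b !))
      ≡⟨ cong ((suc j * suc b) *_) ([m+n]Cm*[m!*n!]≡[m+n]! m b) ⟩
    (suc j * suc b) * (m + b) !
      ≡⟨ cong (_* (m + b) !) (sizeAfter b j) ⟩
    suc (m + b) !
      ≡⟨ cong _! (sym (sizeAfter b j)) ⟩
    (suc j * suc b) !
      ≡⟨ cong _! (*-comm (suc j) (suc b)) ⟩
    (suc b * suc j) ! ∎
    where
    m = suc b * j
    B = (m + b) C m
    rearrange : ∀ a b c d e f g → (a * b) * ((c * d) * ((e * f) * g)) ≡ (c * e) * (a * (f * (b * (d * g))))
    rearrange = solve-∀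
    sizeAfter : ∀ b j → suc j * suc b ≡ suc (suc b * j + b)
    sizeAfter = solve-∀

  typedPartitions-spec : ∀ b js → typedPartitions b js * denomFrom (suc b) js ≡ weightFrom (suc b) js !
  typedPartitions-spec b []       = refl
  typedPartitions-spec b (j ∷ js) = begin
    (B * blockPartitions b j * typedPartitions (suc b) js) * ((j ! * (suc b !) ^ j) * denomFrom (2 + b) js)
      ≡⟨ rearrange B (blockPartitions b j) (typedPartitions (suc b) js) (j !) ((suc b !) ^ j) (denomFrom (2 + b) js) ⟩
    B * ((blockPartitions b j * (j ! * (suc b !) ^ j)) * (typedPartitions (suc b) js * denomFrom (2 + b) js))
      ≡⟨ cong₂ (λ u v → B * (u * v)) (blockPartitions-spec b j) (typedPartitions-spec (suc b) js) ⟩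
    B * (m ! * w !)
      ≡⟨ [m+n]Cm*[m!*n!]≡[m+n]! m w ⟩
    (m + w) ! ∎
    where
    m = suc b * j
    w = weightFrom (2 + b) js
    B = (m + w) C m
    rearrange : ∀ a b c d e f → (a * b * c) * ((d * e) * f) ≡ a * ((b * (d * e)) * (c * f))
    rearrange = solve-∀

  bellCoeff≡typedPartitions : ∀ js → bellCoeff (weightFrom 1 js) js ≡ typedPartitions 0 js
  bellCoeff≡typedPartitions js = begin
    (weightFrom 1 js ! / denomFrom 1 js) {{denomFrom-nz 1 js}}
      ≡⟨ cong (λ t → (t / denomFrom 1 js) {{denomFrom-nz 1 js}}) (sym (typedPartitions-spec 0 js)) ⟩
    (typedPartitions 0 js * denomFrom 1 js / denomFrom 1 js) {{denomFrom-nz 1 js}}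
      ≡⟨ m*n/n≡m (typedPartitions 0 js) (denomFrom 1 js) {{denomFrom-nz 1 js}} ⟩
    typedPartitions 0 js ∎

  bellCoeff-multinomial : ∀ {n k} js → sumJ js ≡ k → weightFrom 1 js ≡ n →
    k ! * (bellCoeff n js * factorialPowersFrom 1 js) ≡ n ! * multinomial js
  bellCoeff-multinomial js refl refl = begin
    sumJ js ! * (bellCoeff (weightFrom 1 js) js * F)
      ≡⟨ cong₂ (λ s t → s * (t * F)) (sym (multinomial*factorialProduct≡sumJ! js)) (bellCoeff≡typedPartitions js) ⟩
    multinomial js * Π! * (typedPartitions 0 js * F)
      ≡⟨ rearrange (multinomial js) Π! (typedPartitions 0 js) F ⟩
    (typedPartitions 0 js * (Π! * F)) * multinomial js
      ≡⟨ cong (λ t → (typedPartitions 0 js * t) * multinomial js) (sym (denomFrom≡factorialProduct*factorialPowersFrom 1 js)) ⟩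
    (typedPartitions 0 js * denomFrom 1 js) * multinomial js
      ≡⟨ cong (_* multinomial js) (typedPartitions-spec 0 js) ⟩
    weightFrom 1 js ! * multinomial js ∎
    where
    Π! = factorialProduct js
    F = factorialPowersFrom 1 js
    rearrange : ∀ a b c d → a * b * (c * d) ≡ (c * (b * d)) * a
    rearrange = solve-∀

  compositions : ℕ → ℕ → ℕ
  compositions zero    zero    = 1
  compositions zero    (suc i) = 0
  compositions (suc k) zero    = 0
  compositions (suc k) (suc i) = compositions (suc k) i + compositions k i

  compositions-below : ∀ {k i} → i < k → compositions k i ≡ 0
  compositions-below {suc k} {zero}  _         = refl
  compositions-below {suc k} {suc i} (s≤s i<k) =
    cong₂ _+_ (compositions-below (m<n⇒m<1+n i<k)) (compositions-below i<k)

  compositions≡C : ∀ k i → compositions (suc k) (suc i) ≡ i C k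
  compositions≡C zero    zero    = refl
  compositions≡C (suc k) zero    = refl
  compositions≡C zero    (suc i) = trans (+-identityʳ _) (compositions≡C 0 i)
  compositions≡C (suc k) (suc i) = begin
    compositions (2 + k) (suc i) + compositions (suc k) (suc i)
      ≡⟨ cong₂ _+_ (compositions≡C (suc k) i) (compositions≡C k i) ⟩
    i C suc k + i C k
      ≡⟨ +-comm (i C suc k) (i C k) ⟩
    i C k + i C suc k
      ≡⟨ nCk+nC[k+1]≡[n+1]C[k+1] i k ⟩
    suc i C suc k ∎

  +≡ᵇ-shift : ∀ a s k → a ≤ k → (a + s ≡ᵇ k) ≡ (s ≡ᵇ k ∸ a)
  +≡ᵇ-shift zero    s k       _         = refl
  +≡ᵇ-shift (suc a) s (suc k) (s≤s a≤k) = +≡ᵇ-shift a s k a≤k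

  +≡ᵇ-false : ∀ a s k → k < a → (a + s ≡ᵇ k) ≡ false
  +≡ᵇ-false (suc a) s zero    _         = refl
  +≡ᵇ-false (suc a) s (suc k) (s≤s k<a) = +≡ᵇ-false a s k k<a

module Sums {c ℓ} (R : CommutativeRing c ℓ) where

  open import Data.Bool using (Bool; true; false; T)
  open import Data.Fin using (toℕ)
  open import Data.Fin.Properties using (toℕ<n)
  open import Data.List using (List; []; _∷_; _++_; map; filterᵇ; concatMap; applyUpTo)
  open import Data.Nat as ℕ using (zero; suc; _∸_; _<_; _≤_)
  import Data.Nat.Properties as ℕ
  open import Data.Unit using (tt)
  open import Relation.Binary.PropositionalEquality as ≡ using (_≡_)

  open CommutativeRing R
  open import Algebra.Properties.Semiring.Sum semiring
    using (sum; ∑-distrib-+; ∑-comm; *-distribˡ-sum; sum-cong-≋; sum-replicate-zero)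
  open import Algebra.Properties.Semiring.Mult semiring using (_×_; ×-congʳ; ×-assocˡ; ×-assoc-*; ×-comm-*)
  open import Algebra.Properties.CommutativeMonoid.Mult +-commutativeMonoid using (×-distrib-+)
  open import Algebra.Properties.Semiring.Exp semiring using (_^_)
  open import Relation.Binary.Reasoning.Setoid setoid

  ×ₙ≡× : ∀ n a → _×ₙ_ R n a ≡ n × a
  ×ₙ≡× zero    a = ≡.refl
  ×ₙ≡× (suc n) a = ≡.cong (a +_) (×ₙ≡× n a)

  ^ₙ≡^ : ∀ a n → _^ₙ_ R a n ≡ a ^ n
  ^ₙ≡^ a zero    = ≡.refl
  ^ₙ≡^ a (suc n) = ≡.cong (a *_) (^ₙ≡^ a n)

  ×-zeroʳ : ∀ n → n × 0# ≈ 0#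
  ×-zeroʳ zero    = refl
  ×-zeroʳ (suc n) = trans (+-identityˡ _) (×-zeroʳ n)

  ∑< : ℕ → (ℕ → Carrier) → Carrier
  ∑< L h = sum {L} (λ i → h (toℕ i))

  ∑<-cong : ∀ L {h h′} → (∀ i → i < L → h i ≈ h′ i) → ∑< L h ≈ ∑< L h′
  ∑<-cong L h≈h′ = sum-cong-≋ {L} (λ i → h≈h′ (toℕ i) (toℕ<n i))

  ∑<-zero : ∀ L {h} → (∀ i → i < L → h i ≈ 0#) → ∑< L h ≈ 0#
  ∑<-zero L h≈0 = trans (∑<-cong L h≈0) (sum-replicate-zero L)

  ∑<-+ : ∀ L f g → ∑< L (λ i → f i + g i) ≈ ∑< L f + ∑< L g
  ∑<-+ L f g = ∑-distrib-+ {L} (λ i → f (toℕ i)) (λ i → g (toℕ i))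

  *-distribˡ-∑< : ∀ L x h → x * ∑< L h ≈ ∑< L (λ i → x * h i)
  *-distribˡ-∑< L x h = *-distribˡ-sum {L} x (λ i → h (toℕ i))

  ∑<-comm : ∀ L M (f : ℕ → ℕ → Carrier) → ∑< L (λ a → ∑< M (f a)) ≈ ∑< M (λ b → ∑< L (λ a → f a b))
  ∑<-comm L M f = ∑-comm {L} {M} (λ a b → f (toℕ a) (toℕ b))

  ×-distrib-∑< : ∀ m L h → m × ∑< L h ≈ ∑< L (λ i → m × h i)
  ×-distrib-∑< m zero    h = ×-zeroʳ m
  ×-distrib-∑< m (suc L) h = trans (×-distrib-+ _ _ m) (+-congˡ (×-distrib-∑< m L (λ i → h (suc i))))

  ∑<-split : ∀ L M h → ∑< (L ℕ.+ M) h ≈ ∑< L h + ∑< M (λ t → h (L ℕ.+ t))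
  ∑<-split zero    M h = sym (+-identityˡ _)
  ∑<-split (suc L) M h = trans (+-congˡ (∑<-split L M (λ i → h (suc i)))) (sym (+-assoc _ _ _))

  ∑<-snoc : ∀ L h → ∑< (suc L) h ≈ ∑< L h + h L
  ∑<-snoc zero    h = trans (+-identityʳ _) (sym (+-identityˡ _))
  ∑<-snoc (suc L) h = trans (+-congˡ (∑<-snoc L (λ i → h (suc i)))) (sym (+-assoc _ _ _))

  ∑<-reverse : ∀ n h → ∑< (suc n) h ≈ ∑< (suc n) (λ a → h (n ∸ a))
  ∑<-reverse zero    h = refl
  ∑<-reverse (suc n) h = begin
    h 0 + ∑< (suc n) (λ a → h (suc a))         ≈⟨ +-congˡ (∑<-reverse n (λ a → h (suc a))) ⟩
    h 0 + ∑< (suc n) (λ a → h (suc (n ∸ a)))   ≈⟨ +-comm _ _ ⟩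
    ∑< (suc n) (λ a → h (suc (n ∸ a))) + h 0   ≈⟨ +-cong (∑<-cong (suc n) reindex) (reflexive (≡.cong h (≡.sym (ℕ.n∸n≡0 n)))) ⟩
    ∑< (suc n) (λ a → h (suc n ∸ a)) + h (suc n ∸ suc n) ≈⟨ ∑<-snoc (suc n) (λ a → h (suc n ∸ a)) ⟨
    ∑< (suc (suc n)) (λ a → h (suc n ∸ a))     ∎
    where
    reindex : ∀ a → a < suc n → h (suc (n ∸ a)) ≈ h (suc n ∸ a)
    reindex a a<1+n = reflexive (≡.cong h (≡.sym (ℕ.+-∸-assoc 1 (ℕ.≤-pred a<1+n))))

  ∑<-extend : ∀ L M h → (∀ i → L ≤ i → h i ≈ 0#) → ∑< L h ≈ ∑< (L ℕ.+ M) h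
  ∑<-extend L M h tail≈0 = sym (begin
    ∑< (L ℕ.+ M) h                          ≈⟨ ∑<-split L M h ⟩
    ∑< L h + ∑< M (λ t → h (L ℕ.+ t))       ≈⟨ +-congˡ (∑<-zero M (λ t _ → tail≈0 (L ℕ.+ t) (ℕ.m≤m+n L t))) ⟩
    ∑< L h + 0#                             ≈⟨ +-identityʳ _ ⟩
    ∑< L h                                  ∎)

  ∑<-dropInitial : ∀ k L h → (∀ i → i < k → h i ≈ 0#) → ∑< (k ℕ.+ L) h ≈ ∑< L (λ t → h (k ℕ.+ t))
  ∑<-dropInitial k L h init≈0 = begin
    ∑< (k ℕ.+ L) h                          ≈⟨ ∑<-split k L h ⟩
    ∑< k h + ∑< L (λ t → h (k ℕ.+ t))       ≈⟨ +-congʳ (∑<-zero k init≈0) ⟩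
    0# + ∑< L (λ t → h (k ℕ.+ t))           ≈⟨ +-identityˡ _ ⟩
    ∑< L (λ t → h (k ℕ.+ t))                ∎

  sumR-map-applyUpTo : ∀ (g : ℕ → Carrier) f L → sumR R (map g (applyUpTo f L)) ≈ ∑< L (λ a → g (f a))
  sumR-map-applyUpTo g f zero    = refl
  sumR-map-applyUpTo g f (suc L) = +-congˡ (sumR-map-applyUpTo g (λ a → f (suc a)) L)

  sumFromTo≈∑< : ∀ a b f → sumFromTo R a b f ≈ ∑< (suc b ∸ a) (λ t → f (a ℕ.+ t))
  sumFromTo≈∑< a b f = sumR-map-applyUpTo (λ t → f (a ℕ.+ t)) (λ t → t) (suc b ∸ a)

  module _ {a} {A : Set a} where

    sumWhere : (A → Bool) → (A → Carrier) → List A → Carrier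
    sumWhere p g l = sumR R (map g (filterᵇ p l))

    sumWhere-cong : ∀ p {g g′} l → (∀ v → T (p v) → g v ≈ g′ v) → sumWhere p g l ≈ sumWhere p g′ l
    sumWhere-cong p []      g≈g′ = refl
    sumWhere-cong p (v ∷ l) g≈g′ with p v in pv
    ... | true  = +-cong (g≈g′ v (≡.subst T (≡.sym pv) tt)) (sumWhere-cong p l g≈g′)
    ... | false = sumWhere-cong p l g≈g′

    sumWhere-≗ : ∀ {p q} g l → (∀ v → p v ≡ q v) → sumWhere p g l ≡ sumWhere q g l
    sumWhere-≗         g []      p≗q = ≡.refl
    sumWhere-≗ {p} {q} g (v ∷ l) p≗q with p v | q v | p≗q v
    ... | true  | .true  | ≡.refl = ≡.cong (g v +_) (sumWhere-≗ g l p≗q)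
    ... | false | .false | ≡.refl = sumWhere-≗ g l p≗q

    sumWhere-none : ∀ {p g} l → (∀ v → p v ≡ false) → sumWhere p g l ≈ 0#
    sumWhere-none         []      none = refl
    sumWhere-none {p} {g} (v ∷ l) none rewrite none v = sumWhere-none {p} {g} l none

    sumWhere-++ : ∀ p g xs ys → sumWhere p g (xs ++ ys) ≈ sumWhere p g xs + sumWhere p g ys
    sumWhere-++ p g []       ys = sym (+-identityˡ _)
    sumWhere-++ p g (v ∷ xs) ys with p v
    ... | true  = trans (+-congˡ (sumWhere-++ p g xs ys)) (sym (+-assoc _ _ _))
    ... | false = sumWhere-++ p g xs ys

    sumWhere-concatMap : ∀ p g (f : ℕ → List A) h N →
      sumWhere p g (concatMap f (applyUpTo h N)) ≈ ∑< N (λ a → sumWhere p g (f (h a)))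
    sumWhere-concatMap p g f h zero    = refl
    sumWhere-concatMap p g f h (suc N) =
      trans (sumWhere-++ p g (f (h 0)) _) (+-congˡ (sumWhere-concatMap p g f (λ a → h (suc a)) N))

    ×-distrib-sumWhere : ∀ m p g l → m × sumWhere p g l ≈ sumWhere p (λ v → m × g v) l
    ×-distrib-sumWhere m p g []      = ×-zeroʳ m
    ×-distrib-sumWhere m p g (v ∷ l) with p v
    ... | true  = trans (×-distrib-+ _ _ m) (+-congˡ (×-distrib-sumWhere m p g l))
    ... | false = ×-distrib-sumWhere m p g l

    *-distribˡ-sumWhere : ∀ x p g l → x * sumWhere p g l ≈ sumWhere p (λ v → x * g v) l
    *-distribˡ-sumWhere x p g []      = zeroʳ x
    *-distribˡ-sumWhere x p g (v ∷ l) with p v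
    ... | true  = trans (distribˡ x _ _) (+-congˡ (*-distribˡ-sumWhere x p g l))
    ... | false = *-distribˡ-sumWhere x p g l

  sumWhere-map : ∀ {a b} {A : Set a} {B : Set b} p g (f : B → A) l →
    sumWhere p g (map f l) ≡ sumWhere (λ v → p (f v)) (λ v → g (f v)) l
  sumWhere-map p g f []      = ≡.refl
  sumWhere-map p g f (v ∷ l) with p (f v)
  ... | true  = ≡.cong (g (f v) +_) (sumWhere-map p g f l)
  ... | false = sumWhere-map p g f l

  ×-*-× : ∀ a b u v → (a × u) * (b × v) ≈ (a ℕ.* b) × (u * v)
  ×-*-× a b u v = begin
    (a × u) * (b × v)    ≈⟨ ×-assoc-* a u (b × v) ⟩
    a × (u * (b × v))    ≈⟨ ×-congʳ a (×-comm-* b u v) ⟩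
    a × (b × (u * v))    ≈⟨ ×-assocˡ (u * v) a b ⟩
    (a ℕ.* b) × (u * v)  ∎

  ×-^ : ∀ a u j → (a × u) ^ j ≈ (a ℕ.^ j) × (u ^ j)
  ×-^ a u zero    = sym (+-identityʳ 1#)
  ×-^ a u (suc j) = trans (*-congˡ (×-^ a u j)) (×-*-× a (a ℕ.^ j) u (u ^ j))

module PowerSeries {c ℓ} (R : CommutativeRing c ℓ) where

  open import Data.Nat as ℕ using (zero; suc; _∸_; _<_; _≤_; z≤n; s≤s)
  import Data.Nat.Properties as ℕ
  open import Data.Nat.Combinatorics using (_C_)
  open import Data.Product using (_,_)
  import Algebra.Properties.CommutativeSemiring.Binomial
  open import Relation.Binary.PropositionalEquality as ≡ using (_≡_)

  open CommutativeRing R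
  open Sums R
  open import Algebra.Properties.Semiring.Mult semiring using (_×_; ×-congʳ; ×-comm-*)
  open import Algebra.Properties.Semiring.Exp semiring using (_^_)
  open import Algebra.Properties.CommutativeSemigroup +-commutativeSemigroup
    using () renaming (interchange to +-interchange)
  open import Relation.Binary.Reasoning.Setoid setoid

  Series : Set c
  Series = ℕ → Carrier

  infix 4 _≐_
  _≐_ : Series → Series → Set ℓ
  f ≐ g = ∀ n → f n ≈ g n

  infixl 6 _+ₛ_
  _+ₛ_ : Series → Series → Series
  (f +ₛ g) n = f n + g n

  -ₛ_ : Series → Series
  (-ₛ f) n = - f n

  0ₛ : Series
  0ₛ _ = 0#

  1ₛ : Series
  1ₛ zero    = 1#
  1ₛ (suc _) = 0#

  -- Cauchy product, unfolded along f = f 0 + t · (f ∘ suc).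
  infixl 7 _*ₛ_
  _*ₛ_ : Series → Series → Series
  (f *ₛ g) zero    = f 0 * g 0
  (f *ₛ g) (suc n) = f 0 * g (suc n) + ((λ m → f (suc m)) *ₛ g) n

  *ₛ-coeff : ∀ f g n → (f *ₛ g) n ≈ ∑< (suc n) (λ a → f a * g (n ∸ a))
  *ₛ-coeff f g zero    = sym (+-identityʳ _)
  *ₛ-coeff f g (suc n) = +-congˡ (*ₛ-coeff (λ m → f (suc m)) g n)

  *ₛ-congˡ : ∀ {f f′} g → f ≐ f′ → f *ₛ g ≐ f′ *ₛ g
  *ₛ-congˡ g f≐f′ zero    = *-congʳ (f≐f′ 0)
  *ₛ-congˡ g f≐f′ (suc n) = +-cong (*-congʳ (f≐f′ 0)) (*ₛ-congˡ g (λ m → f≐f′ (suc m)) n)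

  *ₛ-congʳ : ∀ f {g g′} → g ≐ g′ → f *ₛ g ≐ f *ₛ g′
  *ₛ-congʳ f g≐g′ zero    = *-congˡ (g≐g′ 0)
  *ₛ-congʳ f g≐g′ (suc n) = +-cong (*-congˡ (g≐g′ (suc n))) (*ₛ-congʳ (λ m → f (suc m)) g≐g′ n)

  *ₛ-zeroˡ : ∀ g → 0ₛ *ₛ g ≐ 0ₛ
  *ₛ-zeroˡ g zero    = zeroˡ _
  *ₛ-zeroˡ g (suc n) = trans (+-cong (zeroˡ _) (*ₛ-zeroˡ g n)) (+-identityˡ 0#)

  *ₛ-identityˡ : ∀ g → 1ₛ *ₛ g ≐ g
  *ₛ-identityˡ g zero    = *-identityˡ _
  *ₛ-identityˡ g (suc n) = trans (+-cong (*-identityˡ _) (*ₛ-zeroˡ g n)) (+-identityʳ _)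

  *ₛ-distribʳ : ∀ h f g → (f +ₛ g) *ₛ h ≐ f *ₛ h +ₛ g *ₛ h
  *ₛ-distribʳ h f g zero    = distribʳ _ _ _
  *ₛ-distribʳ h f g (suc n) =
    trans (+-cong (distribʳ _ _ _) (*ₛ-distribʳ h (λ m → f (suc m)) (λ m → g (suc m)) n))
          (+-interchange _ _ _ _)

  *ₛ-scaleˡ : ∀ a f g → (λ m → a * f m) *ₛ g ≐ (λ m → a * (f *ₛ g) m)
  *ₛ-scaleˡ a f g zero    = *-assoc _ _ _
  *ₛ-scaleˡ a f g (suc n) =
    trans (+-cong (*-assoc _ _ _) (*ₛ-scaleˡ a (λ m → f (suc m)) g n)) (sym (distribˡ _ _ _))

  *ₛ-assoc : ∀ f g h → (f *ₛ g) *ₛ h ≐ f *ₛ (g *ₛ h)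
  *ₛ-assoc f g h zero    = *-assoc _ _ _
  *ₛ-assoc f g h (suc n) = begin
    (f 0 * g 0) * h (suc n) + ((λ m → (f *ₛ g) (suc m)) *ₛ h) n
      ≈⟨ +-cong (*-assoc _ _ _) (*ₛ-distribʳ h (λ m → f 0 * g (suc m)) (f′ *ₛ g) n) ⟩
    f 0 * (g 0 * h (suc n)) + (((λ m → f 0 * g (suc m)) *ₛ h) n + ((f′ *ₛ g) *ₛ h) n)
      ≈⟨ +-congˡ (+-cong (*ₛ-scaleˡ (f 0) (λ m → g (suc m)) h n) (*ₛ-assoc f′ g h n)) ⟩
    f 0 * (g 0 * h (suc n)) + (f 0 * ((λ m → g (suc m)) *ₛ h) n + (f′ *ₛ (g *ₛ h)) n)
      ≈⟨ +-assoc _ _ _ ⟨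
    (f 0 * (g 0 * h (suc n)) + f 0 * ((λ m → g (suc m)) *ₛ h) n) + (f′ *ₛ (g *ₛ h)) n
      ≈⟨ +-congʳ (distribˡ _ _ _) ⟨
    f 0 * (g *ₛ h) (suc n) + (f′ *ₛ (g *ₛ h)) n ∎
    where f′ = λ m → f (suc m)

  *ₛ-comm : ∀ f g → f *ₛ g ≐ g *ₛ f
  *ₛ-comm f g n = begin
    (f *ₛ g) n                                   ≈⟨ *ₛ-coeff f g n ⟩
    ∑< (suc n) (λ a → f a * g (n ∸ a))           ≈⟨ ∑<-reverse n (λ a → f a * g (n ∸ a)) ⟩
    ∑< (suc n) (λ a → f (n ∸ a) * g (n ∸ (n ∸ a))) ≈⟨ ∑<-cong (suc n) swap ⟩
    ∑< (suc n) (λ a → g a * f (n ∸ a))           ≈⟨ *ₛ-coeff g f n ⟨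
    (g *ₛ f) n                                   ∎
    where
    swap : ∀ a → a < suc n → f (n ∸ a) * g (n ∸ (n ∸ a)) ≈ g a * f (n ∸ a)
    swap a a<1+n = trans (*-comm _ _) (*-congʳ (reflexive (≡.cong g (ℕ.m∸[m∸n]≡n (ℕ.≤-pred a<1+n)))))

  *ₛ-distribˡ : ∀ f g h → f *ₛ (g +ₛ h) ≐ f *ₛ g +ₛ f *ₛ h
  *ₛ-distribˡ f g h n =
    trans (*ₛ-comm f (g +ₛ h) n) (trans (*ₛ-distribʳ f g h n) (+-cong (*ₛ-comm g f n) (*ₛ-comm h f n)))

  seriesRing : CommutativeRing c ℓ
  seriesRing = record
    { Carrier = Series
    ; _≈_ = _≐_
    ; _+_ = _+ₛ_
    ; _*_ = _*ₛ_
    ; -_ = -ₛ_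
    ; 0# = 0ₛ
    ; 1# = 1ₛ
    ; isCommutativeRing = record
      { isRing = record
        { +-isAbelianGroup = record
          { isGroup = record
            { isMonoid = record
              { isSemigroup = record
                { isMagma = record
                  { isEquivalence = record
                    { refl = λ _ → refl ; sym = λ f≐g n → sym (f≐g n) ; trans = λ f≐g g≐h n → trans (f≐g n) (g≐h n) }
                  ; ∙-cong = λ f≐f′ g≐g′ n → +-cong (f≐f′ n) (g≐g′ n) }
                ; assoc = λ _ _ _ _ → +-assoc _ _ _ }
              ; identity = (λ _ _ → +-identityˡ _) , (λ _ _ → +-identityʳ _) }
            ; inverse = (λ _ _ → -‿inverseˡ _) , (λ _ _ → -‿inverseʳ _)
            ; ⁻¹-cong = λ f≐g n → -‿cong (f≐g n) }
          ; comm = λ _ _ _ → +-comm _ _ }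
        ; *-cong = λ {f} {f′} {g} f≐f′ g≐g′ n → trans (*ₛ-congˡ g f≐f′ n) (*ₛ-congʳ f′ g≐g′ n)
        ; *-assoc = *ₛ-assoc
        ; *-identity = *ₛ-identityˡ , (λ g n → trans (*ₛ-comm g 1ₛ n) (*ₛ-identityˡ g n))
        ; distrib = *ₛ-distribˡ , *ₛ-distribʳ }
      ; *-comm = *ₛ-comm } }

  private
    module S = CommutativeRing seriesRing
    module Σₛ = Sums seriesRing
    module Binomialₛ = Algebra.Properties.CommutativeSemiring.Binomial S.commutativeSemiring

  open import Algebra.Properties.Semiring.Exp S.semiring public using () renaming (_^_ to _^ₛ_)
  open import Algebra.Properties.Semiring.Mult S.semiring using () renaming (_×_ to _×ₛ_)

  ∑<ₛ-coeff : ∀ L F n → Σₛ.∑< L F n ≈ ∑< L (λ j → F j n)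
  ∑<ₛ-coeff zero    F n = refl
  ∑<ₛ-coeff (suc L) F n = +-congˡ (∑<ₛ-coeff L (λ j → F (suc j)) n)

  ×ₛ-coeff : ∀ m f n → (m ×ₛ f) n ≈ m × f n
  ×ₛ-coeff zero    f n = refl
  ×ₛ-coeff (suc m) f n = +-congˡ (×ₛ-coeff m f n)

  binomial-coeff : ∀ A B k n →
    ((A +ₛ B) ^ₛ k) n ≈ ∑< (suc k) (λ j → (k C j) × ((A ^ₛ j) *ₛ (B ^ₛ (k ∸ j))) n)
  binomial-coeff A B k n = begin
    ((A +ₛ B) ^ₛ k) n                                        ≈⟨ Binomialₛ.theorem k A B n ⟩
    Σₛ.∑< (suc k) (λ j → (k C j) ×ₛ (A ^ₛ j *ₛ B ^ₛ (k ∸ j))) n ≈⟨ ∑<ₛ-coeff (suc k) term n ⟩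
    ∑< (suc k) (λ j → ((k C j) ×ₛ (A ^ₛ j *ₛ B ^ₛ (k ∸ j))) n) ≈⟨ ∑<-cong (suc k) (λ j _ → ×ₛ-coeff (k C j) (A ^ₛ j *ₛ B ^ₛ (k ∸ j)) n) ⟩
    ∑< (suc k) (λ j → (k C j) × (A ^ₛ j *ₛ B ^ₛ (k ∸ j)) n)    ∎
    where
    term : ℕ → Series
    term j = (k C j) ×ₛ (A ^ₛ j *ₛ B ^ₛ (k ∸ j))

  monomial : Carrier → ℕ → Series
  monomial a zero    zero    = a
  monomial a zero    (suc m) = 0#
  monomial a (suc i) zero    = 0#
  monomial a (suc i) (suc m) = monomial a i m

  monomial-below : ∀ a {i m} → m < i → monomial a i m ≈ 0#
  monomial-below a {suc i} {zero}  _         = refl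
  monomial-below a {suc i} {suc m} (s≤s m<i) = monomial-below a m<i

  monomial-above : ∀ a {i m} → i < m → monomial a i m ≈ 0#
  monomial-above a {zero}  {suc m} _         = refl
  monomial-above a {suc i} {suc m} (s≤s i<m) = monomial-above a i<m

  monomial-at : ∀ a i → monomial a i i ≈ a
  monomial-at a zero    = refl
  monomial-at a (suc i) = monomial-at a i

  *-monomial : ∀ a b i → (λ n → a * monomial b i n) ≐ monomial (a * b) i
  *-monomial a b zero    zero    = refl
  *-monomial a b zero    (suc n) = zeroʳ a
  *-monomial a b (suc i) zero    = zeroʳ a
  *-monomial a b (suc i) (suc n) = *-monomial a b i n

  monomial-*ₛ-≤ : ∀ a {i n} G → i ≤ n → (monomial a i *ₛ G) n ≈ a * G (n ∸ i)
  monomial-*ₛ-≤ a {zero}  {zero}  G _         = refl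
  monomial-*ₛ-≤ a {zero}  {suc n} G _         = trans (+-congˡ (*ₛ-zeroˡ G n)) (+-identityʳ _)
  monomial-*ₛ-≤ a {suc i} {suc n} G (s≤s i≤n) = trans (+-cong (zeroˡ _) (monomial-*ₛ-≤ a G i≤n)) (+-identityˡ _)

  monomial-*ₛ-> : ∀ a {i n} G → n < i → (monomial a i *ₛ G) n ≈ 0#
  monomial-*ₛ-> a {suc i} {zero}  G _         = zeroˡ _
  monomial-*ₛ-> a {suc i} {suc n} G (s≤s n<i) = trans (+-cong (zeroˡ _) (monomial-*ₛ-> a G n<i)) (+-identityˡ _)

  monomial-*ₛ-monomial : ∀ a b i j → monomial a i *ₛ monomial b j ≐ monomial (a * b) (i ℕ.+ j)
  monomial-*ₛ-monomial a b zero    j n       = trans (monomial-*ₛ-≤ a (monomial b j) z≤n) (*-monomial a b j n)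
  monomial-*ₛ-monomial a b (suc i) j zero    = zeroˡ _
  monomial-*ₛ-monomial a b (suc i) j (suc n) =
    trans (+-cong (zeroˡ _) (monomial-*ₛ-monomial a b i j n)) (+-identityˡ _)

  monomial-^ₛ : ∀ a i j → monomial a i ^ₛ j ≐ monomial (a ^ j) (i ℕ.* j)
  monomial-^ₛ a i zero    n rewrite ℕ.*-zeroʳ i = 1ₛ≐monomial n
    where
    1ₛ≐monomial : 1ₛ ≐ monomial 1# 0
    1ₛ≐monomial zero    = refl
    1ₛ≐monomial (suc n) = refl
  monomial-^ₛ a i (suc j) n = begin
    (monomial a i *ₛ monomial a i ^ₛ j) n           ≈⟨ *ₛ-congʳ (monomial a i) (monomial-^ₛ a i j) n ⟩
    (monomial a i *ₛ monomial (a ^ j) (i ℕ.* j)) n ≈⟨ monomial-*ₛ-monomial a (a ^ j) i (i ℕ.* j) n ⟩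
    monomial (a ^ suc j) (i ℕ.+ i ℕ.* j) n          ≡⟨ ≡.cong (λ d → monomial (a ^ suc j) d n) (ℕ.*-suc i j) ⟨
    monomial (a ^ suc j) (i ℕ.* suc j) n            ∎

  infix 4 _≐[≤_]_
  _≐[≤_]_ : Series → ℕ → Series → Set ℓ
  f ≐[≤ N ] g = ∀ m → m ≤ N → f m ≈ g m

  *ₛ-cong-≤ : ∀ {N f f′ g g′} → f ≐[≤ N ] f′ → g ≐[≤ N ] g′ → f *ₛ g ≐[≤ N ] f′ *ₛ g′
  *ₛ-cong-≤ {N} {f} {f′} {g} {g′} f≐f′ g≐g′ m m≤N = begin
    (f *ₛ g) m                            ≈⟨ *ₛ-coeff f g m ⟩
    ∑< (suc m) (λ a → f a * g (m ∸ a))    ≈⟨ ∑<-cong (suc m) termwise ⟩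
    ∑< (suc m) (λ a → f′ a * g′ (m ∸ a))  ≈⟨ *ₛ-coeff f′ g′ m ⟨
    (f′ *ₛ g′) m                          ∎
    where
    termwise : ∀ a → a < suc m → f a * g (m ∸ a) ≈ f′ a * g′ (m ∸ a)
    termwise a a<1+m = *-cong (f≐f′ a (ℕ.≤-trans (ℕ.≤-pred a<1+m) m≤N)) (g≐g′ (m ∸ a) (ℕ.≤-trans (ℕ.m∸n≤m m a) m≤N))

  ^ₛ-cong-≤ : ∀ {N f g} k → f ≐[≤ N ] g → f ^ₛ k ≐[≤ N ] g ^ₛ k
  ^ₛ-cong-≤ zero    f≐g m _ = refl
  ^ₛ-cong-≤ (suc k) f≐g     = *ₛ-cong-≤ f≐g (^ₛ-cong-≤ k f≐g)

  ^ₛ-vanish : ∀ {X} → X 0 ≈ 0# → ∀ i {m} → m < i → (X ^ₛ i) m ≈ 0#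
  ^ₛ-vanish {X} X₀≈0 (suc i) {zero}  _         = trans (*-congʳ X₀≈0) (zeroˡ _)
  ^ₛ-vanish {X} X₀≈0 (suc i) {suc m} (s≤s m<i) = begin
    (X *ₛ X ^ₛ i) (suc m)                                                     ≈⟨ *ₛ-coeff X (X ^ₛ i) (suc m) ⟩
    X 0 * (X ^ₛ i) (suc m) + ∑< (suc m) (λ a → X (suc a) * (X ^ₛ i) (m ∸ a)) ≈⟨ +-cong (X₀*≈0 _) (∑<-zero (suc m) tail≈0) ⟩
    0# + 0#                                                                   ≈⟨ +-identityˡ 0# ⟩
    0#                                                                        ∎
    where
    X₀*≈0 : ∀ y → X 0 * y ≈ 0#
    X₀*≈0 y = trans (*-congʳ X₀≈0) (zeroˡ y)
    tail≈0 : ∀ a → a < suc m → X (suc a) * (X ^ₛ i) (m ∸ a) ≈ 0#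
    tail≈0 a _ = trans (*-congˡ (^ₛ-vanish {X} X₀≈0 i (ℕ.≤-<-trans (ℕ.m∸n≤m m a) m<i))) (zeroʳ _)

  series₊ : (ℕ → Carrier) → Series
  series₊ z zero    = 0#
  series₊ z (suc n) = z (suc n)

  -- substitute a = Σᵢ a i · Xⁱ; as X has no constant term, only the Xⁱ with i ≤ n reach tⁿ.
  module Substitution (X : Series) (X₀≈0 : X 0 ≈ 0#) where

    substitute : (ℕ → ℕ) → Series
    substitute a n = ∑< (suc n) (λ i → a i × (X ^ₛ i) n)

    substitute-extend : ∀ a {n} N → n ≤ N → substitute a n ≈ ∑< (suc N) (λ i → a i × (X ^ₛ i) n)
    substitute-extend a {n} N n≤N = begin
      ∑< (suc n) h                  ≈⟨ ∑<-extend (suc n) (N ∸ n) h beyond-n≈0 ⟩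
      ∑< (suc n ℕ.+ (N ∸ n)) h      ≡⟨ ≡.cong (λ L → ∑< (suc L) h) (ℕ.m+[n∸m]≡n n≤N) ⟩
      ∑< (suc N) h                  ∎
      where
      h = λ i → a i × (X ^ₛ i) n
      beyond-n≈0 : ∀ i → suc n ≤ i → h i ≈ 0#
      beyond-n≈0 i n<i = trans (×-congʳ (a i) (^ₛ-vanish X₀≈0 i n<i)) (×-zeroʳ (a i))

    X*substitute : ∀ a n → (X *ₛ substitute a) n ≈ ∑< n (λ i → a i × (X ^ₛ suc i) n)
    X*substitute a n = begin
      (X *ₛ substitute a) n
        ≈⟨ *ₛ-coeff X (substitute a) n ⟩
      ∑< (suc n) (λ b → X b * substitute a (n ∸ b))
        ≈⟨ ∑<-cong (suc n) (λ b _ → *-congˡ {X b} (substitute-extend a {n ∸ b} n (ℕ.m∸n≤m n b))) ⟩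
      ∑< (suc n) (λ b → X b * ∑< (suc n) (λ i → a i × (X ^ₛ i) (n ∸ b)))
        ≈⟨ ∑<-cong (suc n) (λ b _ → *-distribˡ-∑< (suc n) (X b) (λ i → a i × (X ^ₛ i) (n ∸ b))) ⟩
      ∑< (suc n) (λ b → ∑< (suc n) (λ i → X b * (a i × (X ^ₛ i) (n ∸ b))))
        ≈⟨ ∑<-comm (suc n) (suc n) (λ b i → X b * (a i × (X ^ₛ i) (n ∸ b))) ⟩
      ∑< (suc n) (λ i → ∑< (suc n) (λ b → X b * (a i × (X ^ₛ i) (n ∸ b))))
        ≈⟨ ∑<-cong (suc n) (λ i _ → pull-out (a i) (X ^ₛ i)) ⟩
      ∑< (suc n) (λ i → a i × (X ^ₛ suc i) n)
        ≈⟨ ∑<-snoc n (λ i → a i × (X ^ₛ suc i) n) ⟩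
      ∑< n (λ i → a i × (X ^ₛ suc i) n) + a n × (X ^ₛ suc n) n
        ≈⟨ +-congˡ (trans (×-congʳ (a n) (^ₛ-vanish X₀≈0 (suc n) (ℕ.n<1+n n))) (×-zeroʳ (a n))) ⟩
      ∑< n (λ i → a i × (X ^ₛ suc i) n) + 0#
        ≈⟨ +-identityʳ _ ⟩
      ∑< n (λ i → a i × (X ^ₛ suc i) n) ∎
      where
      pull-out : ∀ m G → ∑< (suc n) (λ b → X b * (m × G (n ∸ b))) ≈ m × (X *ₛ G) n
      pull-out m G = begin
        ∑< (suc n) (λ b → X b * (m × G (n ∸ b)))  ≈⟨ ∑<-cong (suc n) (λ b _ → ×-comm-* m (X b) (G (n ∸ b))) ⟩
        ∑< (suc n) (λ b → m × (X b * G (n ∸ b)))  ≈⟨ ×-distrib-∑< m (suc n) (λ b → X b * G (n ∸ b)) ⟨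
        m × ∑< (suc n) (λ b → X b * G (n ∸ b))    ≈⟨ ×-congʳ m (*ₛ-coeff X G n) ⟨
        m × (X *ₛ G) n                            ∎

module OneMinus {c ℓ} (A : CommutativeRing c ℓ) where

  open CommutativeRing A
  open import Algebra.Properties.Ring ring using (x[y-z]≈xy-xz)
  open import Algebra.Properties.Group +-group using (∙-cancelʳ)
  open import Relation.Binary.Reasoning.Setoid setoid

  *[1-x]+x*≈ : ∀ x z → z * (1# - x) + x * z ≈ z
  *[1-x]+x*≈ x z = begin
    z * (1# - x) + x * z          ≈⟨ +-congʳ (x[y-z]≈xy-xz z 1# x) ⟩
    (z * 1# - z * x) + x * z      ≈⟨ +-congʳ (+-cong (*-identityʳ z) (-‿cong (*-comm z x))) ⟩
    (z - x * z) + x * z           ≈⟨ +-assoc z (- (x * z)) (x * z) ⟩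
    z + (- (x * z) + x * z)       ≈⟨ +-congˡ (-‿inverseˡ (x * z)) ⟩
    z + 0#                        ≈⟨ +-identityʳ z ⟩
    z                             ∎

  *[1-x]≈⇒fixpoint : ∀ {x z v} → z * (1# - x) ≈ v → z ≈ x * z + v
  *[1-x]≈⇒fixpoint {x} {z} {v} z[1-x]≈v = begin
    z                      ≈⟨ *[1-x]+x*≈ x z ⟨
    z * (1# - x) + x * z   ≈⟨ +-congʳ z[1-x]≈v ⟩
    v + x * z              ≈⟨ +-comm v (x * z) ⟩
    x * z + v              ∎

  fixpoint⇒*[1-x]≈ : ∀ {x z v} → z ≈ x * z + v → z * (1# - x) ≈ v
  fixpoint⇒*[1-x]≈ {x} {z} {v} z≈xz+v = ∙-cancelʳ (x * z) (z * (1# - x)) v (begin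
    z * (1# - x) + x * z   ≈⟨ *[1-x]+x*≈ x z ⟩
    z                      ≈⟨ z≈xz+v ⟩
    x * z + v              ≈⟨ +-comm (x * z) v ⟩
    v + x * z              ∎)

  fixpoint-unique : ∀ {x w z v} → w * (1# - x) ≈ 1# → z ≈ x * z + v → z ≈ w * v
  fixpoint-unique {x} {w} {z} {v} w[1-x]≈1 z≈xz+v = begin
    z                      ≈⟨ *-identityˡ z ⟨
    1# * z                 ≈⟨ *-congʳ w[1-x]≈1 ⟨
    w * (1# - x) * z       ≈⟨ *-assoc w (1# - x) z ⟩
    w * ((1# - x) * z)     ≈⟨ *-congˡ (*-comm (1# - x) z) ⟩
    w * (z * (1# - x))     ≈⟨ *-congˡ (fixpoint⇒*[1-x]≈ z≈xz+v) ⟩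
    w * v                  ∎

module ExponentialFormula {c ℓ} (R : CommutativeRing c ℓ) (z : ℕ → CommutativeRing.Carrier R) where

  open import Data.Bool using (Bool; T; _∧_)
  open import Data.Bool.Properties using (T-∧; ∧-zeroʳ)
  open import Data.List using (List; []; _∷_; map)
  open import Data.Nat as ℕ using (zero; suc; _∸_; _<_; _≤_; _≡ᵇ_; _!; z≤n; s≤s)
  import Data.Nat.Properties as ℕ
  open import Data.Nat.Combinatorics using (_C_; k>n⇒nCk≡0)
  open import Data.Product using (proj₁; proj₂)
  open import Data.Sum using (inj₁; inj₂)
  open import Data.Empty using (⊥-elim)
  open import Function using (Equivalence)
  open import Relation.Nullary using (yes; no)
  open import Relation.Binary.PropositionalEquality as ≡ using (_≡_)

  open CommutativeRing R
  open Counting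
  open Sums R
  open PowerSeries R
  open import Algebra.Properties.Semiring.Mult semiring using (_×_; ×-congʳ; ×-congˡ; ×-assocˡ; ×-comm-*)
  open import Algebra.Properties.Semiring.Exp semiring using (_^_)
  open import Relation.Binary.Reasoning.Setoid setoid

  admissibleFrom : ℕ → ℕ → ℕ → List ℕ → Bool
  admissibleFrom i k n js = (sumJ js ≡ᵇ k) ∧ (weightFrom i js ≡ᵇ n)

  admissibleFrom-cons : ∀ {i k n j} v → j ≤ k → i ℕ.* j ≤ n →
    admissibleFrom i k n (j ∷ v) ≡ admissibleFrom (suc i) (k ∸ j) (n ∸ i ℕ.* j) v
  admissibleFrom-cons {i} {j = j} v j≤k ij≤n =
    ≡.cong₂ _∧_ (+≡ᵇ-shift j (sumJ v) _ j≤k) (+≡ᵇ-shift (i ℕ.* j) (weightFrom (suc i) v) _ ij≤n)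

  admissibleFrom-cons-sum : ∀ {i k n j} v → k < j → admissibleFrom i k n (j ∷ v) ≡ Bool.false
  admissibleFrom-cons-sum {i} {n = n} {j} v k<j = ≡.cong (_∧ (weightFrom i (j ∷ v) ≡ᵇ n)) (+≡ᵇ-false j (sumJ v) _ k<j)

  admissibleFrom-cons-weight : ∀ {i k n j} v → n < i ℕ.* j → admissibleFrom i k n (j ∷ v) ≡ Bool.false
  admissibleFrom-cons-weight {i} {k} {j = j} v n<ij =
    ≡.trans (≡.cong ((j ℕ.+ sumJ v ≡ᵇ k) ∧_) (+≡ᵇ-false (i ℕ.* j) (weightFrom (suc i) v) _ n<ij)) (∧-zeroʳ _)

  segment : ℕ → ℕ → Series
  segment i zero    = 0ₛ
  segment i (suc L) = monomial (z i) i +ₛ segment (suc i) L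

  multinomialTerm : ℕ → List ℕ → Carrier
  multinomialTerm i js = multinomial js × monoFrom R z i js

  multinomialTerm-cons : ∀ {i k j} v → j ℕ.+ sumJ v ≡ k →
    multinomialTerm i (j ∷ v) ≈ (k C j) × (z i ^ j * multinomialTerm (suc i) v)
  multinomialTerm-cons {i} {k} {j} v ≡.refl = begin
    ((k C j) ℕ.* multinomial v) × (zᵢʲ * m)   ≈⟨ ×-assocˡ _ (k C j) (multinomial v) ⟨
    (k C j) × (multinomial v × (zᵢʲ * m))     ≈⟨ ×-congʳ (k C j) (×-comm-* (multinomial v) zᵢʲ m) ⟨
    (k C j) × (zᵢʲ * multinomialTerm (suc i) v)     ≡⟨ ≡.cong (λ u → (k C j) × (u * multinomialTerm (suc i) v)) (^ₙ≡^ (z i) j) ⟩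
    (k C j) × (z i ^ j * multinomialTerm (suc i) v) ∎
    where
    zᵢʲ = _^ₙ_ R (z i) j
    m = monoFrom R z (suc i) v

  admissibleFrom⇒sumJ : ∀ {i k n} js → T (admissibleFrom i k n js) → sumJ js ≡ k
  admissibleFrom⇒sumJ {k = k} js adm = ℕ.≡ᵇ⇒≡ (sumJ js) k (proj₁ (Equivalence.to T-∧ adm))

  admissibleFrom⇒weight : ∀ {i k n} js → T (admissibleFrom i k n js) → weightFrom i js ≡ n
  admissibleFrom⇒weight {i} {n = n} js adm = ℕ.≡ᵇ⇒≡ (weightFrom i js) n (proj₂ (Equivalence.to T-∧ adm))

  multinomial-expansion : ∀ B L i k n → k ≤ B →
    sumWhere (admissibleFrom i k n) (multinomialTerm i) (tuples B L) ≈ (segment i L ^ₛ k) n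

  -- The tuples with first entry j contribute the j-th term of the binomial expansion of
  -- (z i tⁱ + segment (suc i) L) ^ k.
  multinomial-expansion-slice : ∀ B L i k n j → k ≤ B →
    sumWhere (λ v → admissibleFrom i k n (j ∷ v)) (λ v → multinomialTerm i (j ∷ v)) (tuples B L)
      ≈ (k C j) × (monomial (z i) i ^ₛ j *ₛ segment (suc i) L ^ₛ (k ∸ j)) n

  multinomial-expansion B zero    i zero    zero    _   = trans (+-identityʳ _) (+-identityʳ _)
  multinomial-expansion B zero    i zero    (suc n) _   = refl
  multinomial-expansion B zero    i (suc k) n       _   = sym (*ₛ-zeroˡ _ n)
  multinomial-expansion B (suc L) i k       n       k≤B = begin
    sumWhere p g (tuples B (suc L))
      ≈⟨ sumWhere-concatMap p g (λ j → map (j ∷_) (tuples B L)) (λ j → j) (suc B) ⟩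
    ∑< (suc B) (λ j → sumWhere p g (map (j ∷_) (tuples B L)))
      ≈⟨ ∑<-cong (suc B) (λ j _ → trans (reflexive (sumWhere-map p g (j ∷_) (tuples B L)))
                                        (multinomial-expansion-slice B L i k n j k≤B)) ⟩
    ∑< (suc B) H
      ≡⟨ ≡.cong (λ N → ∑< N H) (≡.cong suc (ℕ.m+[n∸m]≡n k≤B)) ⟨
    ∑< (suc k ℕ.+ (B ∸ k)) H
      ≈⟨ ∑<-extend (suc k) (B ∸ k) H (λ j k<j → ×-congˡ (k>n⇒nCk≡0 k<j)) ⟨
    ∑< (suc k) H
      ≈⟨ binomial-coeff (monomial (z i) i) (segment (suc i) L) k n ⟨
    (segment i (suc L) ^ₛ k) n ∎
    where
    p = admissibleFrom i k n
    g = multinomialTerm i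
    H : ℕ → Carrier
    H j = (k C j) × (monomial (z i) i ^ₛ j *ₛ segment (suc i) L ^ₛ (k ∸ j)) n

  multinomial-expansion-slice B L i k n j k≤B with j ℕ.≤? k
  ... | no j≰k = trans (sumWhere-none (tuples B L) (λ v → admissibleFrom-cons-sum {i} {k} {n} v (ℕ.≰⇒> j≰k)))
                       (sym (×-congˡ (k>n⇒nCk≡0 (ℕ.≰⇒> j≰k))))
  ... | yes j≤k with i ℕ.* j ℕ.≤? n
  ...   | no ij≰n = trans (sumWhere-none (tuples B L) (λ v → admissibleFrom-cons-weight {i} {k} {n} v (ℕ.≰⇒> ij≰n)))
                         (sym (trans (×-congʳ (k C j) power*G≈0) (×-zeroʳ (k C j))))
    where
    G = segment (suc i) L ^ₛ (k ∸ j)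
    power*G≈0 : (monomial (z i) i ^ₛ j *ₛ G) n ≈ 0#
    power*G≈0 = trans (*ₛ-congˡ G (monomial-^ₛ (z i) i j) n) (monomial-*ₛ-> (z i ^ j) G (ℕ.≰⇒> ij≰n))
  ...   | yes ij≤n = begin
    sumWhere (λ v → admissibleFrom i k n (j ∷ v)) (λ v → multinomialTerm i (j ∷ v)) l
      ≈⟨ sumWhere-cong (λ v → admissibleFrom i k n (j ∷ v)) l (λ v adm → multinomialTerm-cons v (admissibleFrom⇒sumJ {i} {k} {n} (j ∷ v) adm)) ⟩
    sumWhere (λ v → admissibleFrom i k n (j ∷ v)) (λ v → (k C j) × (z i ^ j * multinomialTerm (suc i) v)) l
      ≡⟨ sumWhere-≗ _ l (λ v → admissibleFrom-cons {i} v j≤k ij≤n) ⟩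
    sumWhere q (λ v → (k C j) × (z i ^ j * multinomialTerm (suc i) v)) l
      ≈⟨ ×-distrib-sumWhere (k C j) q _ l ⟨
    (k C j) × sumWhere q (λ v → z i ^ j * multinomialTerm (suc i) v) l
      ≈⟨ ×-congʳ (k C j) (*-distribˡ-sumWhere (z i ^ j) q (multinomialTerm (suc i)) l) ⟨
    (k C j) × (z i ^ j * sumWhere q (multinomialTerm (suc i)) l)
      ≈⟨ ×-congʳ (k C j) (*-congˡ (multinomial-expansion B L (suc i) (k ∸ j) (n ∸ i ℕ.* j) (ℕ.≤-trans (ℕ.m∸n≤m k j) k≤B))) ⟩
    (k C j) × (z i ^ j * G (n ∸ i ℕ.* j))
      ≈⟨ ×-congʳ (k C j) power*G ⟨
    (k C j) × (monomial (z i) i ^ₛ j *ₛ G) n ∎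
    where
    l = tuples B L
    q = admissibleFrom (suc i) (k ∸ j) (n ∸ i ℕ.* j)
    G = segment (suc i) L ^ₛ (k ∸ j)
    power*G : (monomial (z i) i ^ₛ j *ₛ G) n ≈ z i ^ j * G (n ∸ i ℕ.* j)
    power*G = trans (*ₛ-congˡ G (monomial-^ₛ (z i) i j) n) (monomial-*ₛ-≤ (z i ^ j) G ij≤n)

  segment-below : ∀ L {i m} → m < i → segment i L m ≈ 0#
  segment-below zero        _   = refl
  segment-below (suc L) {i} m<i =
    trans (+-cong (monomial-below (z i) m<i) (segment-below L (ℕ.m<n⇒m<1+n m<i))) (+-identityˡ 0#)

  segment-inside : ∀ L {i m} → i ≤ m → m < i ℕ.+ L → segment i L m ≈ z m
  segment-inside zero    {i}     i≤m m<i+0 = ⊥-elim (ℕ.<⇒≱ (≡.subst (_ <_) (ℕ.+-identityʳ i) m<i+0) i≤m)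
  segment-inside (suc L) {i} {m} i≤m m<i+1+L with ℕ.m≤n⇒m<n∨m≡n i≤m
  ... | inj₂ ≡.refl =
    trans (+-cong (monomial-at (z i) i) (segment-below L (ℕ.n<1+n i))) (+-identityʳ _)
  ... | inj₁ i<m    =
    trans (+-cong (monomial-above (z i) i<m) (segment-inside L i<m (≡.subst (m <_) (ℕ.+-suc i L) m<i+1+L)))
          (+-identityˡ _)

  segment≐[≤]series₊ : ∀ n → segment 1 n ≐[≤ n ] series₊ z
  segment≐[≤]series₊ n zero    _   = segment-below n (s≤s z≤n)
  segment≐[≤]series₊ n (suc m) m<n = segment-inside n (s≤s z≤n) (s≤s m<n)

  monoFrom-factScaled : ∀ i js → monoFrom R (factScaled R z) i js ≈ factorialPowersFrom i js × monoFrom R z i js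
  monoFrom-factScaled i []       = sym (+-identityʳ 1#)
  monoFrom-factScaled i (j ∷ js) = begin
    _^ₙ_ R (_×ₙ_ R (i !) (z i)) j * monoFrom R (factScaled R z) (suc i) js
      ≡⟨ ≡.cong (λ u → _^ₙ_ R u j * monoFrom R (factScaled R z) (suc i) js) (×ₙ≡× (i !) (z i)) ⟩
    _^ₙ_ R ((i !) × z i) j * monoFrom R (factScaled R z) (suc i) js
      ≡⟨ ≡.cong (_* monoFrom R (factScaled R z) (suc i) js) (^ₙ≡^ ((i !) × z i) j) ⟩
    ((i !) × z i) ^ j * monoFrom R (factScaled R z) (suc i) js
      ≈⟨ *-cong (×-^ (i !) (z i) j) (monoFrom-factScaled (suc i) js) ⟩
    (((i !) ℕ.^ j) × (z i ^ j)) * (factorialPowersFrom (suc i) js × monoFrom R z (suc i) js)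
      ≈⟨ ×-*-× ((i !) ℕ.^ j) (factorialPowersFrom (suc i) js) (z i ^ j) (monoFrom R z (suc i) js) ⟩
    factorialPowersFrom i (j ∷ js) × (z i ^ j * monoFrom R z (suc i) js)
      ≡⟨ ≡.cong (λ u → factorialPowersFrom i (j ∷ js) × (u * monoFrom R z (suc i) js)) (^ₙ≡^ (z i) j) ⟨
    factorialPowersFrom i (j ∷ js) × monoFrom R z i (j ∷ js) ∎

  exponentialFormula : ∀ {n k} → k ≤ n → (k !) × Bell R n k (factScaled R z) ≈ (n !) × (series₊ z ^ₛ k) n
  exponentialFormula {n} {k} k≤n = begin
    (k !) × sumWhere p bellTerm l                      ≈⟨ ×-distrib-sumWhere (k !) p bellTerm l ⟩
    sumWhere p (λ v → (k !) × bellTerm v) l            ≈⟨ sumWhere-cong p l termwise ⟩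
    sumWhere p (λ v → (n !) × multinomialTerm 1 v) l   ≈⟨ ×-distrib-sumWhere (n !) p (multinomialTerm 1) l ⟨
    (n !) × sumWhere p (multinomialTerm 1) l           ≈⟨ ×-congʳ (n !) (multinomial-expansion n n 1 k n k≤n) ⟩
    (n !) × (segment 1 n ^ₛ k) n                       ≈⟨ ×-congʳ (n !) (^ₛ-cong-≤ k (segment≐[≤]series₊ n) n ℕ.≤-refl) ⟩
    (n !) × (series₊ z ^ₛ k) n                         ∎
    where
    p = admissibleFrom 1 k n
    l = tuples n n
    bellTerm : List ℕ → Carrier
    bellTerm js = _×ₙ_ R (bellCoeff n js) (monoFrom R (factScaled R z) 1 js)
    termwise : ∀ v → T (p v) → (k !) × bellTerm v ≈ (n !) × multinomialTerm 1 v
    termwise v adm = begin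
      (k !) × bellTerm v                                ≡⟨ ≡.cong ((k !) ×_) (×ₙ≡× (bellCoeff n v) _) ⟩
      (k !) × (bellCoeff n v × monoFrom R (factScaled R z) 1 v)
        ≈⟨ ×-congʳ (k !) (×-congʳ (bellCoeff n v) (monoFrom-factScaled 1 v)) ⟩
      (k !) × (bellCoeff n v × (F × m))                 ≈⟨ ×-congʳ (k !) (×-assocˡ m (bellCoeff n v) F) ⟩
      (k !) × ((bellCoeff n v ℕ.* F) × m)               ≈⟨ ×-assocˡ m (k !) (bellCoeff n v ℕ.* F) ⟩
      (k ! ℕ.* (bellCoeff n v ℕ.* F)) × m
        ≡⟨ ≡.cong (_× m) (bellCoeff-multinomial v (admissibleFrom⇒sumJ v adm) (admissibleFrom⇒weight v adm)) ⟩
      (n ! ℕ.* multinomial v) × m                     ≈⟨ ×-assocˡ m (n !) (multinomial v) ⟨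
      (n !) × multinomialTerm 1 v                       ∎
      where
      F = factorialPowersFrom 1 v
      m = monoFrom R z 1 v

module InvertTransform {c ℓ} (R : CommutativeRing c ℓ) (x y : ℕ → CommutativeRing.Carrier R)
                       (inv : IsInvertTransform R x y) where

  open import Data.Nat as ℕ using (zero; suc; _∸_; _≤_; _!; s≤s; z≤n)
  import Data.Nat.Properties as ℕ
  open import Data.Nat.Combinatorics using (_C_)
  open import Relation.Binary.PropositionalEquality as ≡ using (_≡_)

  open CommutativeRing R
  open Counting
  open Sums R
  open PowerSeries R
  open import Algebra.Properties.Semiring.Mult semiring using (_×_; ×-homo-+; ×-congʳ; ×-congˡ; ×-assocˡ)
  open ExponentialFormula R x using (exponentialFormula)
  open import Algebra.Properties.Ring ring using (-0#≈0#)
  import Relation.Binary.Reasoning.Setoid as SetoidReasoning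

  private
    module S where
      open CommutativeRing seriesRing public
      open import Algebra.Properties.Group (CommutativeRing.+-group seriesRing) public using (∙-cancelˡ)
      open OneMinus seriesRing public

  X Y W : Series
  X = series₊ x
  Y = series₊ y
  W = seriesY R y

  open Substitution X refl

  W*[1-X]≐1 : W *ₛ (1ₛ S.- X) ≐ 1ₛ
  W*[1-X]≐1 n = trans (*ₛ-congʳ W 1-X n) (W*[1-X] n)
    where
    1-X : 1ₛ S.- X ≐ seriesOneMinusX R x
    1-X zero    = trans (+-congˡ -0#≈0#) (+-identityʳ 1#)
    1-X (suc n) = +-identityˡ _
    W*[1-X] : W *ₛ seriesOneMinusX R x ≐ 1ₛ
    W*[1-X] zero    = *-identityˡ 1#
    W*[1-X] (suc n) = trans (*ₛ-coeff W (seriesOneMinusX R x) (suc n))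
                            (trans (sym (sumFromTo≈∑< 0 (suc n) _)) (inv (suc n) (s≤s z≤n)))

  Y≐X*Y+X : Y ≐ X *ₛ Y +ₛ X
  Y≐X*Y+X = S.∙-cancelˡ 1ₛ Y (X *ₛ Y +ₛ X) (begin
    1ₛ +ₛ Y                    ≈⟨ W≐1+Y ⟨
    W                          ≈⟨ S.*[1-x]≈⇒fixpoint W*[1-X]≐1 ⟩
    X *ₛ W +ₛ 1ₛ               ≈⟨ S.+-congʳ (S.*-congˡ W≐1+Y) ⟩
    X *ₛ (1ₛ +ₛ Y) +ₛ 1ₛ       ≈⟨ S.+-congʳ (S.distribˡ X 1ₛ Y) ⟩
    (X *ₛ 1ₛ +ₛ X *ₛ Y) +ₛ 1ₛ  ≈⟨ S.+-congʳ (S.+-congʳ (S.*-identityʳ X)) ⟩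
    (X +ₛ X *ₛ Y) +ₛ 1ₛ        ≈⟨ S.+-comm _ 1ₛ ⟩
    1ₛ +ₛ (X +ₛ X *ₛ Y)        ≈⟨ S.+-congˡ (S.+-comm X (X *ₛ Y)) ⟩
    1ₛ +ₛ (X *ₛ Y +ₛ X)        ∎)
    where
    open SetoidReasoning S.setoid
    W≐1+Y : W ≐ 1ₛ +ₛ Y
    W≐1+Y zero    = sym (+-identityʳ 1#)
    W≐1+Y (suc n) = sym (+-identityˡ _)

  Σcompositions : ℕ → Series
  Σcompositions k = substitute (compositions k)

  Σcompositions-zero : Σcompositions 0 ≐ 1ₛ
  Σcompositions-zero n = trans (+-cong (+-identityʳ _) (∑<-zero n (λ _ _ → refl))) (+-identityʳ _)

  Σcompositions-suc : ∀ k → Σcompositions (suc k) ≐ X *ₛ Σcompositions (suc k) +ₛ X *ₛ Σcompositions k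
  Σcompositions-suc k n = begin
    0# + ∑< n (λ i → (c₁ i ℕ.+ c₀ i) × P i)            ≈⟨ +-identityˡ _ ⟩
    ∑< n (λ i → (c₁ i ℕ.+ c₀ i) × P i)                 ≈⟨ ∑<-cong n (λ i _ → ×-homo-+ (P i) (c₁ i) (c₀ i)) ⟩
    ∑< n (λ i → c₁ i × P i + c₀ i × P i)               ≈⟨ ∑<-+ n (λ i → c₁ i × P i) (λ i → c₀ i × P i) ⟩
    ∑< n (λ i → c₁ i × P i) + ∑< n (λ i → c₀ i × P i)  ≈⟨ +-cong (X*substitute c₁ n) (X*substitute c₀ n) ⟨
    (X *ₛ Σcompositions (suc k)) n + (X *ₛ Σcompositions k) n ∎
    where
    open SetoidReasoning setoid
    c₁ c₀ : ℕ → ℕ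
    c₁ = compositions (suc k)
    c₀ = compositions k
    P : ℕ → Carrier
    P i = (X ^ₛ suc i) n

  Y^k≐Σcompositions : ∀ k → Y ^ₛ k ≐ Σcompositions k
  Y^k≐Σcompositions zero    = S.sym Σcompositions-zero
  Y^k≐Σcompositions (suc k) = begin
    Y *ₛ Y ^ₛ k                           ≈⟨ S.*-congˡ (Y^k≐Σcompositions k) ⟩
    Y *ₛ Σcompositions k                  ≈⟨ S.fixpoint-unique W*[1-X]≐1 (Y*-fixpoint (Σcompositions k)) ⟩
    W *ₛ (X *ₛ Σcompositions k)           ≈⟨ S.fixpoint-unique W*[1-X]≐1 (Σcompositions-suc k) ⟨
    Σcompositions (suc k)                 ∎
    where
    open SetoidReasoning S.setoid
    Y*-fixpoint : ∀ V → Y *ₛ V ≐ X *ₛ (Y *ₛ V) +ₛ X *ₛ V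
    Y*-fixpoint V = begin
      Y *ₛ V                     ≈⟨ S.*-congʳ Y≐X*Y+X ⟩
      (X *ₛ Y +ₛ X) *ₛ V         ≈⟨ S.distribʳ V (X *ₛ Y) X ⟩
      X *ₛ Y *ₛ V +ₛ X *ₛ V      ≈⟨ S.+-congʳ (S.*-assoc X Y V) ⟩
      X *ₛ (Y *ₛ V) +ₛ X *ₛ V    ∎

  compositions-Bell : ∀ {n k j} → suc j ≤ n →
    (n !) × (compositions (suc k) (suc j) × (X ^ₛ suc j) n)
      ≈ ((j C k) ℕ.* (suc j) !) × Bell R n (suc j) (factScaled R x)
  compositions-Bell {n} {k} {j} j<n = begin
    (n !) × (compositions (suc k) (suc j) × P)     ≡⟨ ≡.cong (λ m → (n !) × (m × P)) (compositions≡C k j) ⟩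
    (n !) × ((j C k) × P)                          ≈⟨ ×-assocˡ P (n !) (j C k) ⟩
    ((n !) ℕ.* (j C k)) × P                        ≡⟨ ≡.cong (_× P) (ℕ.*-comm (n !) (j C k)) ⟩
    ((j C k) ℕ.* (n !)) × P                        ≈⟨ ×-assocˡ P (j C k) (n !) ⟨
    (j C k) × ((n !) × P)                          ≈⟨ ×-congʳ (j C k) (exponentialFormula j<n) ⟨
    (j C k) × ((suc j !) × Bell R n (suc j) (factScaled R x)) ≈⟨ ×-assocˡ _ (j C k) (suc j !) ⟩
    ((j C k) ℕ.* (suc j) !) × Bell R n (suc j) (factScaled R x) ∎
    where
    open SetoidReasoning setoid
    P = (X ^ₛ suc j) n

  n!*Y^k≈∑Bell : ∀ {n k} → suc k ≤ n →
    (n !) × (Y ^ₛ suc k) n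
      ≈ ∑< (n ∸ k) (λ t → (((k ℕ.+ t) C k) ℕ.* (suc (k ℕ.+ t)) !) × Bell R n (suc (k ℕ.+ t)) (factScaled R x))
  n!*Y^k≈∑Bell {n} {k} k<n = begin
    (n !) × (Y ^ₛ suc k) n                       ≈⟨ ×-congʳ (n !) (Y^k≐Σcompositions (suc k) n) ⟩
    (n !) × ∑< (suc n) h                         ≈⟨ ×-distrib-∑< (n !) (suc n) h ⟩
    ∑< (suc n) (λ i → (n !) × h i)               ≡⟨ ≡.cong (λ L → ∑< (suc L) (λ i → (n !) × h i)) (ℕ.m+[n∸m]≡n k≤n) ⟨
    ∑< (suc k ℕ.+ (n ∸ k)) (λ i → (n !) × h i)   ≈⟨ ∑<-dropInitial (suc k) (n ∸ k) _ h≈0 ⟩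
    ∑< (n ∸ k) (λ t → (n !) × h (suc k ℕ.+ t))   ≈⟨ ∑<-cong (n ∸ k) (λ t t<n∸k → compositions-Bell (bound t t<n∸k)) ⟩
    ∑< (n ∸ k) (λ t → (((k ℕ.+ t) C k) ℕ.* (suc (k ℕ.+ t)) !) × Bell R n (suc (k ℕ.+ t)) (factScaled R x)) ∎
    where
    open SetoidReasoning setoid
    k≤n = ℕ.<⇒≤ k<n
    h : ℕ → Carrier
    h i = compositions (suc k) i × (X ^ₛ i) n
    h≈0 : ∀ i → i ℕ.< suc k → (n !) × h i ≈ 0#
    h≈0 i i≤k = trans (×-congʳ (n !) (×-congˡ (compositions-below i≤k))) (×-zeroʳ (n !))
    bound : ∀ t → t ℕ.< n ∸ k → suc (k ℕ.+ t) ≤ n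
    bound t t<n∸k = ≡.subst (suc (k ℕ.+ t) ≤_) (ℕ.m+[n∸m]≡n k≤n) (ℕ.+-monoʳ-< k t<n∸k)

open import Level using (Level)
open import Data.Nat using (_≤_; _∸_; _!; _*_; _+_; suc; s≤s; z≤n)
open import Data.Nat.Combinatorics using (_C_)

mainTheorem7 : ∀ {c ℓ : Level} (R : CommutativeRing c ℓ) (x y : ℕ → CommutativeRing.Carrier R) →
  IsInvertTransform R x y →
  ∀ (n k : ℕ) → 1 ≤ k → k ≤ n →
  CommutativeRing._≈_ R
    (_×ₙ_ R (k !) (Bell R n k (factScaled R y)))
    (sumFromTo R k n (λ i → _×ₙ_ R (((i ∸ 1) C (k ∸ 1)) * (i !)) (Bell R n i (factScaled R x))))
mainTheorem7 R x y inv n (suc k) (s≤s z≤n) k<n = begin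
  _×ₙ_ R (suc k !) (Bell R n (suc k) (factScaled R y))   ≡⟨ ×ₙ≡× (suc k !) _ ⟩
  (suc k !) × Bell R n (suc k) (factScaled R y)         ≈⟨ ExponentialFormula.exponentialFormula R y k<n ⟩
  (n !) × (series₊ y ^ₛ suc k) n                        ≈⟨ InvertTransform.n!*Y^k≈∑Bell R x y inv k<n ⟩
  ∑< (n ∸ k) (λ t → term (suc k + t))                 ≈⟨ ∑<-cong (n ∸ k) (λ t _ → reflexive (≡.sym (term≡termₙ (suc k + t)))) ⟩
  ∑< (n ∸ k) (λ t → termₙ (suc k + t))                ≈⟨ sumFromTo≈∑< (suc k) n termₙ ⟨
  sumFromTo R (suc k) n termₙ                           ∎
  where
  open import Relation.Binary.PropositionalEquality as ≡ using (_≡_)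
  open CommutativeRing R using (Carrier; setoid; reflexive)
  open Sums R
  open PowerSeries R
  open import Algebra.Properties.Semiring.Mult (CommutativeRing.semiring R) using (_×_)
  open import Relation.Binary.Reasoning.Setoid setoid
  term termₙ : ℕ → Carrier
  term  i = (((i ∸ 1) C k) * (i !)) × Bell R n i (factScaled R x)
  termₙ i = _×ₙ_ R (((i ∸ 1) C k) * (i !)) (Bell R n i (factScaled R x))
  term≡termₙ : ∀ i → termₙ i ≡ term i
  term≡termₙ i = ×ₙ≡× (((i ∸ 1) C k) * (i !)) (Bell R n i (factScaled R x))
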